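{- Let $X$ be a $d$-dimensional simplicial complex and $\beta>0$ such that for every nonempty face $\sigma\in X$ of dimension at most $d-2$, the link $X_\sigma$ is a $\beta$-coboundary expander. Let $0\le\ell<k<d$ and let $f\in Z^k(X)$ be a minimal $k$-cocycle, i.e. $\delta f=\mathbf{0}$ and $\|f\|\le\|f+g\|$ for every $g\in B^k(X)$. Then $f$ is $\frac{\ell+1}{\beta}$-double balanced in dimension $\ell$, i.e. for every $\sigma\in X(\ell)$, $$\|f_\sigma\| \le \frac{\ell+1}{\beta}\,\mathbb{E}_{u\in\sigma}\|(f_{\sigma\setminus u})^u\|.$$
   Context: A $d$-dimensional simplicial complex $X$ is a finite downward-closed family of finite sets (faces) whose maximal faces have size $d+1$; $X(j)$ is the set of $j$-faces (size $j+1$), with $X(-1)=\{\emptyset\}$. Standing assumption: $P_d$ on $X(d)$ is uniform; for $j<d$, $P_j$ on $X(j)$ is obtained by drawing $\sigma\sim P_d$ and then a uniformly random $j$-subface. The link of $\sigma$ is $X_\sigma=\{\tau\setminus\sigma:\sigma\subseteq\tau\in X\}$, with the induced (conditional) distributions on its faces. $C^j(X)$ is the $\mathbb{F}_2$-space of functions $X(j)\to\mathbb{F}_2$, and $\|f\|=\Pr_{\sigma\sim P_j}[f(\sigma)\ne0]$, $\mathrm{dist}(f,g)=\|f-g\|$ (on links, computed with link distributions). The coboundary $\delta:C^j(X)\to C^{j+1}(X)$ is $\delta f(\sigma)=\sum_{v\in\sigma}f(\sigma\setminus\{v\})$ mod 2 (with the convention that $C^{ -1}$ consists of functions on $\{\emptyset\}$,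 so $B^0$ is the set of constant functions). $Z^j=\ker\delta$, $B^j=\operatorname{im}\delta$. A complex $Y$ of dimension $m$ is a $\beta$-coboundary expander if for every $j<m$ and every $g\in C^j(Y)\setminus B^j(Y)$, $\|\delta g\|\ge\beta\,\mathrm{dist}(g,B^j(Y))$. For $f\in C^k(X)$, $\sigma\in X(\ell)$, $\ell<k$: localization $f_\sigma\in C^{k-\ell-1}(X_\sigma)$, $f_\sigma(\tau)=f(\sigma\cup\tau)$; restriction $f^\sigma\in C^k(X_\sigma)$, $f^\sigma(\tau)=f(\tau)$; $f_\emptyset=f$. In the claim, $u$ is uniform over the vertices of $\sigma$, and $(f_{\sigma\setminus u})^u\in C^{k-\ell}(X_\sigma)$ is the restriction of $f_{\sigma\setminus u}$ (a cochain on $X_{\sigma\setminus u}$) to the link of $u$ in $X_{\sigma\setminus u}$, namely $X_\sigma$; norms of $f_\sigma$ and $(f_{\sigma\setminus u})^u$ are in $X_\sigma$.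
   Formalization: The expansion constant β is taken to be a positive rational number. -}

module Defs where

open import Data.Bool using (T?; Bool; true; false; _xor_; if_then_else_)
open import Data.Nat using (ℕ; zero; suc; _≤_; _<_; _∸_; _*_)
open import Data.Nat.Combinatorics using (_C_)
open import Data.Fin using (Fin)
open import Data.Fin.Subset using (Subset; inside; outside; _∈_; _⊆_; _∪_; _─_; ⁅_⁆; ∣_∣; ⊥; Empty)
open import Data.Fin.Subset.Properties using (_⊆?_; _∈?_)
open import Data.Vec using ([]; _∷_; _[_]≔_)
open import Data.List as List using (List; []; _∷_; filter; length; map; foldr; concatMap; allFin)
open import Data.Integer using (+_)
open import Data.Rational as ℚ using (ℚ; 0ℚ; _/_)
open import Data.Nat.ListAction using ()
import Data.Nat.ListAction
open import Data.Product using (Σ; ∃; _×_; _,_)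
open import Relation.Binary.PropositionalEquality using (_≡_)
open import Relation.Nullary using (Dec; yes; no; does)
open import Data.Nat.Properties using (_≟_)

filterB : ∀ {A : Set} → (A → Bool) → List A → List A
filterB p = filter (λ x → T? (p x))

-- All subsets of Fin n (every finite vertex set is identified with some Fin n).
allSubsets : ∀ n → List (Subset n)
allSubsets zero = [] ∷ []
allSubsets (suc n) = concatMap (λ s → (outside ∷ s) ∷ (inside ∷ s) ∷ []) (allSubsets n)

Complex : ℕ → Set
Complex n = Subset n → Bool

record IsComplex {n : ℕ} (d : ℕ) (X : Complex n) : Set where
  field
    nonempty     : X ⊥ ≡ true
    downClosed   : ∀ s t → t ⊆ s → X s ≡ true → X t ≡ true
    sizeBound    : ∀ s → X s ≡ true → ∣ s ∣ ≤ suc d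
    pure         : ∀ s → X s ≡ true → ∃ λ t → s ⊆ t × X t ≡ true × ∣ t ∣ ≡ suc d

-- Cochains: F₂-valued functions on faces (values off the relevant faces are irrelevant).
-- A cochain "in C^j" is evaluated on the faces of size j+1.
Cochain : ℕ → Set
Cochain n = Subset n → Bool

-- faces of Y of a given size s (= j-faces with j = s - 1)
faces : ∀ {n} → Complex n → ℕ → List (Subset n)
faces {n} Y s = filterB (λ τ → Y τ Data.Bool.∧ (does (∣ τ ∣ ≟ s))) (allSubsets n)
  where import Data.Bool

subfaces : ∀ {n} → Subset n → ℕ → List (Subset n)
subfaces {n} σ s = filterB (λ τ → does (τ ⊆? σ) Data.Bool.∧ does (∣ τ ∣ ≟ s)) (allSubsets n)
  where import Data.Bool

elems : ∀ {n} → Subset n → List (Fin n)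
elems {n} σ = filterB (λ v → does (v ∈? σ)) (allFin n)

-- a / b as a rational (0 if b = 0)
frac : ℕ → ℕ → ℚ
frac a zero = 0ℚ
frac a (suc b) = (+ a) / suc b

count : ∀ {A : Set} → (A → Bool) → List A → ℕ
count p xs = length (filter (λ x → p x Data.Bool.≟ true) xs)
  where import Data.Bool

-- ‖g‖ for g ∈ C^{s-1}(Y), Y of dimension m:
-- Pr[g(τ) ≠ 0] where σ is a uniform top face (size m+1) and τ a uniform size-s subface of σ.
norm : ∀ {n} → Complex n → (m s : ℕ) → Cochain n → ℚ
norm Y m s g =
  frac (Data.Nat.ListAction.sum (map (λ σ → count g (subfaces σ s)) (faces Y (suc m))))
       (length (faces Y (suc m)) * (suc m C s))

δ : ∀ {n} → Cochain n → Cochain n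
δ g τ = foldr (λ v b → g (τ [ v ]≔ outside) xor b) false (elems τ)

_⊕_ : ∀ {n} → Cochain n → Cochain n → Cochain n
(f ⊕ g) τ = f τ xor g τ

-- g ∈ B^{s-1}(Y). For s = 0 (j = -1), B^{-1} = {0}; otherwise g = δh on the faces of size s.
IsCoboundary : ∀ {n} → Complex n → ℕ → Cochain n → Set
IsCoboundary {n} Y zero g = ∀ τ → Y τ ≡ true → ∣ τ ∣ ≡ 0 → g τ ≡ false
IsCoboundary {n} Y (suc s) g =
  ∃ λ (h : Cochain n) → ∀ τ → Y τ ≡ true → ∣ τ ∣ ≡ suc s → δ h τ ≡ g τ

IsCocycle : ∀ {n} → Complex n → ℕ → Cochain n → Set
IsCocycle Y s g = ∀ τ → Y τ ≡ true → ∣ τ ∣ ≡ suc s → δ g τ ≡ false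

-- Y of dimension m is a β-coboundary expander: for every j < m (s = j+1 ≤ m) and
-- g ∈ C^j(Y) ∖ B^j(Y), ‖δg‖ ≥ β·dist(g, B^j(Y)); dist(g,B) = min_{b∈B} ‖g - b‖ is a
-- minimum over a finite set, so "≥ β·dist" is written as "for some b ∈ B, ‖δg‖ ≥ β‖g - b‖".
IsCoboundaryExpander : ∀ {n} → ℚ → Complex n → ℕ → Set
IsCoboundaryExpander {n} β Y m =
  ∀ s → s ≤ m → (g : Cochain n) → (Relation.Nullary.¬ IsCoboundary Y s g) →
    ∃ λ (b : Cochain n) → IsCoboundary Y s b ×
      (β ℚ.* norm Y m s (g ⊕ b) ℚ.≤ norm Y m (suc s) (δ g))
  where import Relation.Nullary

-- link X_σ = {τ ∖ σ : σ ⊆ τ ∈ X} = {τ : τ ∩ σ = ∅, τ ∪ σ ∈ X}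
disjointB : ∀ {n} → Subset n → Subset n → Bool
disjointB [] [] = true
disjointB (inside ∷ a) (inside ∷ b) = false
disjointB (_ ∷ a) (_ ∷ b) = disjointB a b

link : ∀ {n} → Complex n → Subset n → Complex n
link X σ τ = disjointB τ σ Data.Bool.∧ X (τ ∪ σ)
  where import Data.Bool

localize : ∀ {n} → Cochain n → Subset n → Cochain n
localize f σ τ = f (σ ∪ τ)

-- restriction f^σ(τ) = f(τ) (regarded as a cochain on the link)
restrict : ∀ {n} → Cochain n → Subset n → Cochain n
restrict f σ τ = f τ

mean : List ℚ → ℚ
mean [] = 0ℚ
mean (x ∷ xs) = foldr ℚ._+_ 0ℚ (x ∷ xs) ℚ.* ((+ 1) / suc (length xs))

-- Norms are ratios of flag counts: the numerator of ‖g‖ counts the pairs ρ ⊆ F of a top face F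
-- and a face ρ with g ρ ≠ 0.  The flags of X through σ correspond to the flags of the link X_σ
-- via τ ↦ σ ∪ τ, and a coboundary δh on X_σ lifts to the coboundary of ρ ↦ h (ρ ∖ σ) (zero off
-- the star of σ), which changes f only on faces through σ.  Hence minimality of f passes to f_σ,
-- and in the coboundary expander X_σ a minimal cochain satisfies β‖f_σ‖ ≤ ‖δ f_σ‖.  Finally δf = 0
-- and the Leibniz rule for δ on σ ∪ τ give δ f_σ (τ) = Σ_{u ∈ σ} (f_{σ∖u})^u (τ), so ‖δ f_σ‖ is at
-- most Σ_u ‖(f_{σ∖u})^u‖, which is ℓ + 1 times the mean.

{-# OPTIONS --safe #-}
module Submission where

open import Defs
open import Algebra.Bundles using (CommutativeRing)
import Algebra.Properties.CommutativeMonoid.Sum as MonoidSum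
open import Data.Bool
  using (Bool; true; false; not; _∧_; _∨_; _xor_; if_then_else_; T; T?) renaming (_≟_ to _≟ᵇ_)
open import Data.Bool.Properties
  using (xor-∧-commutativeRing; ∨-identityʳ; ∧-identityʳ; ∧-zeroʳ; ∧-assoc; if-∧; if-swap-then;
         xor-identityʳ; xor-same; T-≡)
open import Data.Empty using (⊥-elim)
open import Data.Fin using (Fin; zero; suc)
open import Data.Fin.Subset using (Subset; inside; outside; ∣_∣; _∪_; _─_; _-_; ⁅_⁆; ⊥; _⊆_)
open import Data.Fin.Subset.Properties using (_∈?_; _⊆?_; p─⊥≡p; ∪-identityʳ; ∪-comm)
open import Data.Integer as ℤ using (+_)
import Data.Integer.Properties as ℤ
open import Data.Integer.Solver using (module +-*-Solver)
open import Data.List using (List; []; _∷_; map; filter; length; foldr; tabulate; concatMap; allFin)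
open import Data.List.Properties using (filter-≐; map-tabulate; map-cong; map-cong-local; length-map)
open import Data.List.Relation.Unary.All as All using (All)
open import Data.List.Relation.Unary.All.Properties using (all-filter)
open import Data.Nat as ℕ using (ℕ; zero; suc; _+_; _≤_; _<_; _∸_; _≟_; z≤n; s≤s)
open import Data.Nat.Combinatorics using (_C_; nCk+nC[k+1]≡[n+1]C[k+1])
open import Data.Nat.ListAction using (sum)
import Data.Nat.Properties as ℕ
open import Data.Nat.Properties
  using (≤-refl; ≤-trans; ≤-reflexive; +-mono-≤; +-identityʳ; +-assoc; +-suc; m≤m+n; m≤n+m;
         +-cancelʳ-≡; +-cancelʳ-≤; *-mono-≤; +-commutativeSemigroup)
open import Algebra.Properties.CommutativeSemigroup +-commutativeSemigroup using (interchange)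
open import Data.Product using (_×_; _,_; proj₁; proj₂)
open import Data.Rational using (ℚ; 0ℚ; 1ℚ; toℚᵘ; Positive; NonNegative; _/_; 1/_; _*_) renaming (_≤_ to _≤ℚ_)
import Data.Rational as ℚ
import Data.Rational.Properties as ℚ
open import Data.Rational.Properties
  using (pos⇒nonZero; toℚᵘ-fromℚᵘ; toℚᵘ-injective; toℚᵘ-mono-≤; toℚᵘ-cancel-≤; *-1-commutativeMonoid)
open import Algebra.Solver.CommutativeMonoid *-1-commutativeMonoid using (solve; _⊜_) renaming (_⊕_ to _∙_)
open import Data.Rational.Unnormalised as ℚᵘ using (mkℚᵘ; *≡*; *≤*)
import Data.Rational.Unnormalised.Properties as ℚᵘ
open import Data.Vec using ([]; _∷_; _[_]≔_)
open import Function using (_∘_; id; Equivalence; mk⇔)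
open import Relation.Binary.PropositionalEquality
  using (_≡_; refl; sym; trans; cong; cong₂; subst; subst₂; module ≡-Reasoning)
open import Relation.Nullary using (Dec; yes; no; does; ¬_)
open import Relation.Nullary.Decidable using (does-⇔; dec-true)
open import Relation.Unary using (Decidable)

private variable
  n : ℕ
  A : Set

-- Indicators and finite sums

infixr 7 [_]·_

[_]·_ : Bool → ℕ → ℕ
[ b ]· x = if b then x else 0

[_] : Bool → ℕ
[ b ] = [ b ]· 1

[]·-zero : ∀ b → [ b ]· 0 ≡ 0
[]·-zero true = refl
[]·-zero false = refl

[]·-distrib-+ : ∀ b x y → [ b ]· (x + y) ≡ [ b ]· x + [ b ]· y
[]·-distrib-+ true x y = refl
[]·-distrib-+ false x y = refl

[]·-cong : ∀ b {x y} → (b ≡ true → x ≡ y) → [ b ]· x ≡ [ b ]· y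
[]·-cong true eq = eq refl
[]·-cong false eq = refl

[]·-mono-≤ : ∀ b {x y} → (b ≡ true → x ≤ y) → [ b ]· x ≤ [ b ]· y
[]·-mono-≤ true le = le refl
[]·-mono-≤ false le = z≤n

[xor]≤ : ∀ a b → [ a xor b ] ≤ [ a ] + [ b ]
[xor]≤ false b = ≤-refl
[xor]≤ true false = ≤-refl
[xor]≤ true true = z≤n

∑ˢ : (Subset n → ℕ) → ℕ
∑ˢ {zero} φ = φ []
∑ˢ {suc n} φ = ∑ˢ (φ ∘ (outside ∷_)) + ∑ˢ (φ ∘ (inside ∷_))

infix 5 ∑ˢ
syntax ∑ˢ (λ F → x) = ∑ˢ[ F ] x

∑ˢ-cong : {φ ψ : Subset n → ℕ} → (∀ F → φ F ≡ ψ F) → ∑ˢ φ ≡ ∑ˢ ψ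
∑ˢ-cong {zero} eq = eq []
∑ˢ-cong {suc n} eq = cong₂ _+_ (∑ˢ-cong (eq ∘ (outside ∷_))) (∑ˢ-cong (eq ∘ (inside ∷_)))

∑ˢ-mono-≤ : {φ ψ : Subset n → ℕ} → (∀ F → φ F ≤ ψ F) → ∑ˢ φ ≤ ∑ˢ ψ
∑ˢ-mono-≤ {zero} le = le []
∑ˢ-mono-≤ {suc n} le = +-mono-≤ (∑ˢ-mono-≤ (le ∘ (outside ∷_))) (∑ˢ-mono-≤ (le ∘ (inside ∷_)))

∑ˢ-zero : ∀ n → ∑ˢ {n} (λ _ → 0) ≡ 0
∑ˢ-zero zero = refl
∑ˢ-zero (suc n) = cong₂ _+_ (∑ˢ-zero n) (∑ˢ-zero n)

∑ˢ-distrib-+ : (φ ψ : Subset n → ℕ) → ∑ˢ[ F ] (φ F + ψ F) ≡ ∑ˢ φ + ∑ˢ ψ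
∑ˢ-distrib-+ {zero} φ ψ = refl
∑ˢ-distrib-+ {suc n} φ ψ =
  trans (cong₂ _+_ (∑ˢ-distrib-+ (φ ∘ (outside ∷_)) (ψ ∘ (outside ∷_)))
                   (∑ˢ-distrib-+ (φ ∘ (inside ∷_)) (ψ ∘ (inside ∷_))))
        (interchange (∑ˢ (φ ∘ (outside ∷_))) (∑ˢ (ψ ∘ (outside ∷_))) _ _)

term≤∑ˢ : (φ : Subset n → ℕ) (F : Subset n) → φ F ≤ ∑ˢ φ
term≤∑ˢ φ [] = ≤-refl
term≤∑ˢ φ (outside ∷ F) = ≤-trans (term≤∑ˢ (φ ∘ (outside ∷_)) F) (m≤m+n _ _)
term≤∑ˢ φ (inside ∷ F) = ≤-trans (term≤∑ˢ (φ ∘ (inside ∷_)) F) (m≤n+m _ _)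

sum-map-allSubsets : ∀ n (φ : Subset n → ℕ) → sum (map φ (allSubsets n)) ≡ ∑ˢ φ
sum-map-allSubsets zero φ = +-identityʳ (φ [])
sum-map-allSubsets (suc n) φ = begin
  sum (map φ (concatMap (λ F → (outside ∷ F) ∷ (inside ∷ F) ∷ []) (allSubsets n)))
    ≡⟨ pairs (allSubsets n) ⟩
  sum (map (λ F → φ (outside ∷ F) + φ (inside ∷ F)) (allSubsets n))
    ≡⟨ sum-map-allSubsets n _ ⟩
  ∑ˢ[ F ] (φ (outside ∷ F) + φ (inside ∷ F))
    ≡⟨ ∑ˢ-distrib-+ (φ ∘ (outside ∷_)) (φ ∘ (inside ∷_)) ⟩
  ∑ˢ φ ∎
  where
  open ≡-Reasoning
  pairs : ∀ Fs → sum (map φ (concatMap (λ F → (outside ∷ F) ∷ (inside ∷ F) ∷ []) Fs))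
               ≡ sum (map (λ F → φ (outside ∷ F) + φ (inside ∷ F)) Fs)
  pairs [] = refl
  pairs (F ∷ Fs) = trans (sym (+-assoc (φ (outside ∷ F)) _ _))
                         (cong (_+_ (φ (outside ∷ F) + φ (inside ∷ F))) (pairs Fs))

sum-map-filter : {P : A → Set} (P? : Decidable P) (f : A → ℕ) (xs : List A) →
  sum (map f (filter P? xs)) ≡ sum (map (λ x → [ does (P? x) ]· f x) xs)
sum-map-filter P? f [] = refl
sum-map-filter P? f (x ∷ xs) with does (P? x)
... | true = cong (_+_ (f x)) (sum-map-filter P? f xs)
... | false = sum-map-filter P? f xs

length-filter : {P : A → Set} (P? : Decidable P) (xs : List A) →
  length (filter P? xs) ≡ sum (map (λ x → [ does (P? x) ]) xs)
length-filter P? [] = refl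
length-filter P? (x ∷ xs) with does (P? x)
... | true = cong suc (length-filter P? xs)
... | false = length-filter P? xs

⨁ˡ : (A → Bool) → List A → Bool
⨁ˡ φ = foldr (λ x b → φ x xor b) false

[⨁ˡ]≤ : (φ : A → Bool) (xs : List A) → [ ⨁ˡ φ xs ] ≤ sum (map (λ x → [ φ x ]) xs)
[⨁ˡ]≤ φ [] = z≤n
[⨁ˡ]≤ φ (x ∷ xs) = ≤-trans ([xor]≤ (φ x) _) (+-mono-≤ (≤-refl {[ φ x ]}) ([⨁ˡ]≤ φ xs))

⨁ˡ-false : (φ : A → Bool) (xs : List A) → (∀ x → φ x ≡ false) → ⨁ˡ φ xs ≡ false
⨁ˡ-false φ [] _ = refl
⨁ˡ-false φ (x ∷ xs) eq = cong₂ _xor_ (eq x) (⨁ˡ-false φ xs eq)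

module Xor = MonoidSum (CommutativeRing.+-commutativeMonoid xor-∧-commutativeRing)

⨁ˡ-filter : {P : A → Set} (P? : Decidable P) (φ : A → Bool) (xs : List A) →
  ⨁ˡ φ (filter P? xs) ≡ ⨁ˡ (λ x → does (P? x) ∧ φ x) xs
⨁ˡ-filter P? φ [] = refl
⨁ˡ-filter P? φ (x ∷ xs) with does (P? x)
... | true = cong (φ x xor_) (⨁ˡ-filter P? φ xs)
... | false = ⨁ˡ-filter P? φ xs

⨁ˡ-tabulate : ∀ n (f : Fin n → A) (φ : A → Bool) → ⨁ˡ φ (tabulate f) ≡ Xor.sum (φ ∘ f)
⨁ˡ-tabulate zero f φ = refl
⨁ˡ-tabulate (suc n) f φ = cong (φ (f zero) xor_) (⨁ˡ-tabulate n (f ∘ suc) φ)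

⨁ˡ-cong : {φ ψ : A → Bool} (xs : List A) → (∀ x → φ x ≡ ψ x) → ⨁ˡ φ xs ≡ ⨁ˡ ψ xs
⨁ˡ-cong [] eq = refl
⨁ˡ-cong (x ∷ xs) eq = cong₂ _xor_ (eq x) (⨁ˡ-cong xs eq)

-- Subsets of Fin n as bit vectors

does-true : (a? : Dec A) → does a? ≡ true → A
does-true (yes a) _ = a

infix 7 _∈ᵇ_ _⊆ᵇ_

_∈ᵇ_ : Fin n → Subset n → Bool
v ∈ᵇ σ = does (v ∈? σ)

_⊆ᵇ_ : Subset n → Subset n → Bool
p ⊆ᵇ q = does (p ⊆? q)

hasSize : Subset n → ℕ → Bool
hasSize F t = does (∣ F ∣ ≟ t)

∈ᵇ-∪ : ∀ (v : Fin n) σ τ → v ∈ᵇ (σ ∪ τ) ≡ (v ∈ᵇ σ ∨ v ∈ᵇ τ)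
∈ᵇ-∪ zero (inside ∷ σ) (t ∷ τ) = refl
∈ᵇ-∪ zero (outside ∷ σ) (inside ∷ τ) = refl
∈ᵇ-∪ zero (outside ∷ σ) (outside ∷ τ) = refl
∈ᵇ-∪ (suc v) (s ∷ σ) (t ∷ τ) = ∈ᵇ-∪ v σ τ

∈ᵇ-disjoint : ∀ (v : Fin n) τ σ → disjointB τ σ ≡ true → v ∈ᵇ σ ≡ true → v ∈ᵇ τ ≡ false
∈ᵇ-disjoint zero (inside ∷ τ) (outside ∷ σ) _ ()
∈ᵇ-disjoint zero (outside ∷ τ) (s ∷ σ) _ _ = refl
∈ᵇ-disjoint (suc v) (inside ∷ τ) (outside ∷ σ) d = ∈ᵇ-disjoint v τ σ d
∈ᵇ-disjoint (suc v) (outside ∷ τ) (s ∷ σ) d = ∈ᵇ-disjoint v τ σ d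

[]≔outside-∪ : ∀ (σ τ : Subset n) v → (σ ∪ τ) [ v ]≔ outside ≡ (σ [ v ]≔ outside) ∪ (τ [ v ]≔ outside)
[]≔outside-∪ (s ∷ σ) (t ∷ τ) zero = refl
[]≔outside-∪ (s ∷ σ) (t ∷ τ) (suc v) = cong ((s ∨ t) ∷_) ([]≔outside-∪ σ τ v)

∉⇒[]≔outside : ∀ (τ : Subset n) v → v ∈ᵇ τ ≡ false → τ [ v ]≔ outside ≡ τ
∉⇒[]≔outside (outside ∷ τ) zero _ = refl
∉⇒[]≔outside (t ∷ τ) (suc v) e = cong (t ∷_) (∉⇒[]≔outside τ v e)

-≡[]≔outside : ∀ (σ : Subset n) v → σ - v ≡ σ [ v ]≔ outside
-≡[]≔outside (s ∷ σ) zero = cong (outside ∷_) (p─⊥≡p σ)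
-≡[]≔outside (s ∷ σ) (suc v) = cong (s ∷_) (-≡[]≔outside σ v)

⊆ᵇ-[]≔outside : ∀ (σ ρ : Subset n) v → σ ⊆ᵇ (ρ [ v ]≔ outside) ≡ (σ ⊆ᵇ ρ ∧ not (v ∈ᵇ σ))
⊆ᵇ-[]≔outside (outside ∷ σ) (r ∷ ρ) zero = sym (∧-identityʳ (σ ⊆ᵇ ρ))
⊆ᵇ-[]≔outside (inside ∷ σ) (outside ∷ ρ) zero = refl
⊆ᵇ-[]≔outside (inside ∷ σ) (inside ∷ ρ) zero = sym (∧-zeroʳ (σ ⊆ᵇ ρ))
⊆ᵇ-[]≔outside (outside ∷ σ) (r ∷ ρ) (suc v) = ⊆ᵇ-[]≔outside σ ρ v
⊆ᵇ-[]≔outside (inside ∷ σ) (outside ∷ ρ) (suc v) = refl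
⊆ᵇ-[]≔outside (inside ∷ σ) (inside ∷ ρ) (suc v) = ⊆ᵇ-[]≔outside σ ρ v

⊆ᵇ-∪ : ∀ (σ τ : Subset n) → σ ⊆ᵇ (σ ∪ τ) ≡ true
⊆ᵇ-∪ [] [] = refl
⊆ᵇ-∪ (inside ∷ σ) (t ∷ τ) = ⊆ᵇ-∪ σ τ
⊆ᵇ-∪ (outside ∷ σ) (t ∷ τ) = ⊆ᵇ-∪ σ τ

⊆ᵇ-trans : ∀ (p q r : Subset n) → p ⊆ᵇ q ≡ true → q ⊆ᵇ r ≡ true → p ⊆ᵇ r ≡ true
⊆ᵇ-trans [] [] [] _ _ = refl
⊆ᵇ-trans (outside ∷ p) (outside ∷ q) (z ∷ r) e₁ e₂ = ⊆ᵇ-trans p q r e₁ e₂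
⊆ᵇ-trans (outside ∷ p) (inside ∷ q) (inside ∷ r) e₁ e₂ = ⊆ᵇ-trans p q r e₁ e₂
⊆ᵇ-trans (inside ∷ p) (inside ∷ q) (inside ∷ r) e₁ e₂ = ⊆ᵇ-trans p q r e₁ e₂

∪-─-cancel : ∀ (σ τ : Subset n) → disjointB τ σ ≡ true → (σ ∪ τ) ─ σ ≡ τ
∪-─-cancel [] [] _ = refl
∪-─-cancel (inside ∷ σ) (outside ∷ τ) d = cong (outside ∷_) (∪-─-cancel σ τ d)
∪-─-cancel (outside ∷ σ) (inside ∷ τ) d = cong (inside ∷_) (∪-─-cancel σ τ d)
∪-─-cancel (outside ∷ σ) (outside ∷ τ) d = cong (outside ∷_) (∪-─-cancel σ τ d)

⊆ᵇ-disjoint : ∀ (τ G σ : Subset n) → τ ⊆ᵇ G ≡ true → disjointB G σ ≡ true → disjointB τ σ ≡ true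
⊆ᵇ-disjoint [] [] [] _ _ = refl
⊆ᵇ-disjoint (inside ∷ τ) (inside ∷ G) (outside ∷ σ) s d = ⊆ᵇ-disjoint τ G σ s d
⊆ᵇ-disjoint (outside ∷ τ) (inside ∷ G) (outside ∷ σ) s d = ⊆ᵇ-disjoint τ G σ s d
⊆ᵇ-disjoint (outside ∷ τ) (outside ∷ G) (x ∷ σ) s d = ⊆ᵇ-disjoint τ G σ s d

[]≔outside-disjoint : ∀ (τ σ : Subset n) v → disjointB τ σ ≡ true → disjointB (τ [ v ]≔ outside) σ ≡ true
[]≔outside-disjoint (inside ∷ τ) (outside ∷ σ) zero d = d
[]≔outside-disjoint (outside ∷ τ) (s ∷ σ) zero d = d
[]≔outside-disjoint (inside ∷ τ) (outside ∷ σ) (suc v) d = []≔outside-disjoint τ σ v d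
[]≔outside-disjoint (outside ∷ τ) (s ∷ σ) (suc v) d = []≔outside-disjoint τ σ v d

∪-⊆ᵇ-∪ : ∀ (τ G σ : Subset n) → disjointB τ σ ≡ true → disjointB G σ ≡ true →
  (τ ∪ σ) ⊆ᵇ (G ∪ σ) ≡ τ ⊆ᵇ G
∪-⊆ᵇ-∪ [] [] [] _ _ = refl
∪-⊆ᵇ-∪ (outside ∷ τ) (outside ∷ G) (inside ∷ σ) d e = ∪-⊆ᵇ-∪ τ G σ d e
∪-⊆ᵇ-∪ (inside ∷ τ) (inside ∷ G) (outside ∷ σ) d e = ∪-⊆ᵇ-∪ τ G σ d e
∪-⊆ᵇ-∪ (inside ∷ τ) (outside ∷ G) (outside ∷ σ) d e = refl
∪-⊆ᵇ-∪ (outside ∷ τ) (inside ∷ G) (outside ∷ σ) d e = ∪-⊆ᵇ-∪ τ G σ d e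
∪-⊆ᵇ-∪ (outside ∷ τ) (outside ∷ G) (outside ∷ σ) d e = ∪-⊆ᵇ-∪ τ G σ d e

∣∪∣ : ∀ (τ σ : Subset n) → disjointB τ σ ≡ true → ∣ τ ∪ σ ∣ ≡ ∣ τ ∣ + ∣ σ ∣
∣∪∣ [] [] _ = refl
∣∪∣ (inside ∷ τ) (outside ∷ σ) d = cong suc (∣∪∣ τ σ d)
∣∪∣ (outside ∷ τ) (inside ∷ σ) d = trans (cong suc (∣∪∣ τ σ d)) (sym (+-suc ∣ τ ∣ ∣ σ ∣))
∣∪∣ (outside ∷ τ) (outside ∷ σ) d = ∣∪∣ τ σ d

∑ˢ-⊇ : ∀ (σ : Subset n) (φ : Subset n → ℕ) →
  ∑ˢ[ F ] [ σ ⊆ᵇ F ]· φ F ≡ ∑ˢ[ G ] [ disjointB G σ ]· φ (G ∪ σ)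
∑ˢ-⊇ [] φ = refl
∑ˢ-⊇ {suc n} (inside ∷ σ) φ =
  trans (cong₂ _+_ (∑ˢ-zero n) refl)
        (trans (∑ˢ-⊇ σ (φ ∘ (inside ∷_)))
               (sym (trans (cong (_+_ (∑ˢ[ G ] [ disjointB G σ ]· φ (inside ∷ G ∪ σ))) (∑ˢ-zero n))
                           (+-identityʳ _))))
∑ˢ-⊇ (outside ∷ σ) φ = cong₂ _+_ (∑ˢ-⊇ σ (φ ∘ (outside ∷_))) (∑ˢ-⊇ σ (φ ∘ (inside ∷_)))

disjoint-⊥ : ∀ (τ : Subset n) → disjointB τ ⊥ ≡ true
disjoint-⊥ [] = refl
disjoint-⊥ (inside ∷ τ) = disjoint-⊥ τ
disjoint-⊥ (outside ∷ τ) = disjoint-⊥ τ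

disjoint-∪⁅⁆ : ∀ (τ σ : Subset n) u → u ∈ᵇ σ ≡ true →
  (disjointB τ ⁅ u ⁆ ∧ disjointB (τ ∪ ⁅ u ⁆) (σ - u)) ≡ disjointB τ σ
disjoint-∪⁅⁆ (inside ∷ τ) (inside ∷ σ) zero _ = refl
disjoint-∪⁅⁆ (outside ∷ τ) (inside ∷ σ) zero _ =
  cong₂ _∧_ (disjoint-⊥ τ) (cong₂ disjointB (∪-identityʳ τ) (p─⊥≡p σ))
disjoint-∪⁅⁆ (inside ∷ τ) (inside ∷ σ) (suc u) _ = ∧-zeroʳ (disjointB τ ⁅ u ⁆)
disjoint-∪⁅⁆ (inside ∷ τ) (outside ∷ σ) (suc u) u∈σ = disjoint-∪⁅⁆ τ σ u u∈σ
disjoint-∪⁅⁆ (outside ∷ τ) (s ∷ σ) (suc u) u∈σ = disjoint-∪⁅⁆ τ σ u u∈σ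

p∪⁅x⁆∪[q-x]≡p∪q : ∀ (τ σ : Subset n) u → u ∈ᵇ σ ≡ true → (τ ∪ ⁅ u ⁆) ∪ (σ - u) ≡ τ ∪ σ
p∪⁅x⁆∪[q-x]≡p∪q (t ∷ τ) (inside ∷ σ) zero _ =
  cong₂ _∷_ (∨-identityʳ (t ∨ true)) (cong₂ _∪_ (∪-identityʳ τ) (p─⊥≡p σ))
p∪⁅x⁆∪[q-x]≡p∪q (t ∷ τ) (s ∷ σ) (suc u) u∈σ =
  cong₂ _∷_ (cong (_∨ s) (∨-identityʳ t)) (p∪⁅x⁆∪[q-x]≡p∪q τ σ u u∈σ)

link-⊆ᵇ : ∀ (G σ : Subset n) → disjointB G σ ≡ true → ∀ τ → link (_⊆ᵇ (G ∪ σ)) σ τ ≡ τ ⊆ᵇ G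
link-⊆ᵇ G σ G#σ τ with disjointB τ σ in τ#σ | τ ⊆ᵇ G in τ⊆G
... | true | _ = trans (∪-⊆ᵇ-∪ τ G σ τ#σ G#σ) τ⊆G
... | false | false = refl
... | false | true = trans (sym τ#σ) (⊆ᵇ-disjoint τ G σ τ⊆G G#σ)

-∪≡[]≔outside : ∀ (σ τ : Subset n) v → disjointB τ σ ≡ true → v ∈ᵇ σ ≡ true →
  (σ - v) ∪ τ ≡ (σ ∪ τ) [ v ]≔ outside
-∪≡[]≔outside σ τ v τ#σ v∈σ = begin
  (σ - v) ∪ τ
    ≡⟨ cong₂ _∪_ (-≡[]≔outside σ v) (sym (∉⇒[]≔outside τ v (∈ᵇ-disjoint v τ σ τ#σ v∈σ))) ⟩
  (σ [ v ]≔ outside) ∪ (τ [ v ]≔ outside)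
    ≡⟨ sym ([]≔outside-∪ σ τ v) ⟩
  (σ ∪ τ) [ v ]≔ outside ∎
  where open ≡-Reasoning

∪[]≔outside : ∀ (σ τ : Subset n) v → v ∈ᵇ σ ≡ false → σ ∪ (τ [ v ]≔ outside) ≡ (σ ∪ τ) [ v ]≔ outside
∪[]≔outside σ τ v v∉σ =
  trans (cong (_∪ (τ [ v ]≔ outside)) (sym (∉⇒[]≔outside σ v v∉σ))) (sym ([]≔outside-∪ σ τ v))

length-elems : ∀ (σ : Subset n) → length (elems σ) ≡ ∣ σ ∣
length-elems {n} σ = trans (length-filter (λ v → T? (v ∈ᵇ σ)) (allFin n)) (count-∈ᵇ σ)
  where
  sum-map-allFin-suc : ∀ {n} (φ : Fin (suc n) → ℕ) →
    sum (map φ (allFin (suc n))) ≡ φ zero + sum (map (φ ∘ suc) (allFin n))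
  sum-map-allFin-suc φ =
    cong (_+_ (φ zero)) (cong sum (trans (map-tabulate suc φ) (sym (map-tabulate id (φ ∘ suc)))))
  count-∈ᵇ : ∀ {n} (σ : Subset n) → sum (map (λ v → [ v ∈ᵇ σ ]) (allFin n)) ≡ ∣ σ ∣
  count-∈ᵇ [] = refl
  count-∈ᵇ (inside ∷ σ) = trans (sum-map-allFin-suc (λ v → [ v ∈ᵇ (inside ∷ σ) ])) (cong suc (count-∈ᵇ σ))
  count-∈ᵇ (outside ∷ σ) = trans (sum-map-allFin-suc (λ v → [ v ∈ᵇ (outside ∷ σ) ])) (count-∈ᵇ σ)

-- Faces, links and flag counts

∧-true : ∀ {a b} → (a ∧ b) ≡ true → a ≡ true × b ≡ true
∧-true {true} e = refl , e

IsDownClosed : Complex n → Set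
IsDownClosed X = ∀ F ρ → ρ ⊆ F → X F ≡ true → X ρ ≡ true

link-downClosed : (X : Complex n) (σ : Subset n) → IsDownClosed X → IsDownClosed (link X σ)
link-downClosed X σ downClosed G τ τ⊆G LG = cong₂ _∧_ τ#σ (downClosed (G ∪ σ) (τ ∪ σ) τσ⊆Gσ XGσ)
  where
  G#σ = proj₁ (∧-true {disjointB G σ} LG)
  XGσ = proj₂ (∧-true {disjointB G σ} LG)
  τ⊆ᵇG = dec-true (τ ⊆? G) τ⊆G
  τ#σ = ⊆ᵇ-disjoint τ G σ τ⊆ᵇG G#σ
  τσ⊆Gσ = does-true ((τ ∪ σ) ⊆? (G ∪ σ)) (trans (∪-⊆ᵇ-∪ τ G σ τ#σ G#σ) τ⊆ᵇG)

link-link : ∀ (X : Complex n) σ u → u ∈ᵇ σ ≡ true → ∀ τ → link (link X (σ - u)) ⁅ u ⁆ τ ≡ link X σ τ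
link-link X σ u u∈σ τ =
  trans (sym (∧-assoc (disjointB τ ⁅ u ⁆) _ _))
        (cong₂ _∧_ (disjoint-∪⁅⁆ τ σ u u∈σ) (cong X (p∪⁅x⁆∪[q-x]≡p∪q τ σ u u∈σ)))

faceSum : Complex n → ℕ → (Subset n → ℕ) → ℕ
faceSum Y t w = ∑ˢ[ F ] [ Y F ∧ hasSize F t ]· w F

-- A face F is itself the complex (_⊆ᵇ F), so the flags ρ ⊆ F are the faces of the faces of Y.
flagSum : Complex n → (t s : ℕ) → (Subset n → ℕ) → ℕ
flagSum Y t s w = faceSum Y t (λ F → faceSum (_⊆ᵇ F) s w)

flagCount : Complex n → (t s : ℕ) → Cochain n → ℕ
flagCount Y t s g = flagSum Y t s (λ ρ → [ g ρ ])

faceCount : Complex n → ℕ → ℕ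
faceCount Y t = faceSum Y t (λ _ → 1)

flagTotal : Complex n → (t s : ℕ) → ℕ
flagTotal Y t s = faceCount Y t ℕ.* (t C s)

norm≡frac-flagCount : ∀ (Y : Complex n) m s g →
  norm Y m s g ≡ frac (flagCount Y (suc m) s g) (flagTotal Y (suc m) s)
norm≡frac-flagCount {n} Y m s g = cong₂ frac numerator (cong (ℕ._* (suc m C s)) denominator)
  where
  open ≡-Reasoning
  isTop : Subset n → Bool
  isTop F = Y F ∧ hasSize F (suc m)
  [b≟true]≡[b] : ∀ b → [ does (b ≟ᵇ true) ] ≡ [ b ]
  [b≟true]≡[b] true = refl
  [b≟true]≡[b] false = refl
  count-subfaces : ∀ F → count g (subfaces F s) ≡ ∑ˢ[ ρ ] [ ρ ⊆ᵇ F ∧ hasSize ρ s ]· [ g ρ ]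
  count-subfaces F = begin
    count g (subfaces F s)
      ≡⟨ length-filter (λ ρ → g ρ ≟ᵇ true) (subfaces F s) ⟩
    sum (map (λ ρ → [ does (g ρ ≟ᵇ true) ]) (subfaces F s))
      ≡⟨ sum-map-filter (λ ρ → T? (ρ ⊆ᵇ F ∧ hasSize ρ s)) _ (allSubsets n) ⟩
    sum (map (λ ρ → [ ρ ⊆ᵇ F ∧ hasSize ρ s ]· [ does (g ρ ≟ᵇ true) ]) (allSubsets n))
      ≡⟨ sum-map-allSubsets n _ ⟩
    ∑ˢ[ ρ ] [ ρ ⊆ᵇ F ∧ hasSize ρ s ]· [ does (g ρ ≟ᵇ true) ]
      ≡⟨ ∑ˢ-cong (λ ρ → cong ([ ρ ⊆ᵇ F ∧ hasSize ρ s ]·_) ([b≟true]≡[b] (g ρ))) ⟩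
    ∑ˢ[ ρ ] [ ρ ⊆ᵇ F ∧ hasSize ρ s ]· [ g ρ ] ∎
  numerator : sum (map (λ F → count g (subfaces F s)) (faces Y (suc m))) ≡ flagCount Y (suc m) s g
  numerator = begin
    sum (map (λ F → count g (subfaces F s)) (faces Y (suc m)))
      ≡⟨ sum-map-filter (λ F → T? (isTop F)) _ (allSubsets n) ⟩
    sum (map (λ F → [ isTop F ]· count g (subfaces F s)) (allSubsets n))
      ≡⟨ sum-map-allSubsets n _ ⟩
    ∑ˢ[ F ] [ isTop F ]· count g (subfaces F s)
      ≡⟨ ∑ˢ-cong (λ F → cong ([ isTop F ]·_) (count-subfaces F)) ⟩
    flagCount Y (suc m) s g ∎
  denominator : length (faces Y (suc m)) ≡ faceCount Y (suc m)
  denominator = trans (length-filter (λ F → T? (isTop F)) (allSubsets n)) (sum-map-allSubsets n _)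

faces-cong : ∀ {Y Y′ : Complex n} → (∀ F → Y F ≡ Y′ F) → ∀ t → faces Y t ≡ faces Y′ t
faces-cong {n} {Y} {Y′} eq t =
  filter-≐ (λ F → T? (Y F ∧ hasSize F t)) (λ F → T? (Y′ F ∧ hasSize F t))
           ( (λ {F} → subst (λ b → T (b ∧ hasSize F t)) (eq F))
           , (λ {F} → subst (λ b → T (b ∧ hasSize F t)) (sym (eq F))))
           (allSubsets n)

norm-cong-complex : ∀ {Y Y′ : Complex n} → (∀ F → Y F ≡ Y′ F) → ∀ m s g → norm Y m s g ≡ norm Y′ m s g
norm-cong-complex eq m s g =
  cong (λ Fs → frac (sum (map (λ F → count g (subfaces F s)) Fs)) (length Fs ℕ.* (suc m C s)))
       (faces-cong eq (suc m))

faceSum-mono-≤ : ∀ (Y : Complex n) t {w w′ : Subset n → ℕ} →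
  (∀ F → Y F ≡ true → ∣ F ∣ ≡ t → w F ≤ w′ F) → faceSum Y t w ≤ faceSum Y t w′
faceSum-mono-≤ Y t le = ∑ˢ-mono-≤ λ F → []·-mono-≤ (Y F ∧ hasSize F t) λ face →
  le F (proj₁ (∧-true face)) (does-true (∣ F ∣ ≟ t) (proj₂ (∧-true face)))

faceSum-cong : ∀ (Y : Complex n) t {w w′ : Subset n → ℕ} →
  (∀ F → Y F ≡ true → ∣ F ∣ ≡ t → w F ≡ w′ F) → faceSum Y t w ≡ faceSum Y t w′
faceSum-cong Y t eq = ∑ˢ-cong λ F → []·-cong (Y F ∧ hasSize F t) λ face →
  eq F (proj₁ (∧-true face)) (does-true (∣ F ∣ ≟ t) (proj₂ (∧-true face)))

faceSum-cong-complex : ∀ {Y Y′ : Complex n} t (w : Subset n → ℕ) → (∀ F → Y F ≡ Y′ F) →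
  faceSum Y t w ≡ faceSum Y′ t w
faceSum-cong-complex t w eq = ∑ˢ-cong λ F → cong (λ b → [ b ∧ hasSize F t ]· w F) (eq F)

faceSum-zero : ∀ (Y : Complex n) t → faceSum Y t (λ _ → 0) ≡ 0
faceSum-zero {n} Y t = trans (∑ˢ-cong λ F → []·-zero (Y F ∧ hasSize F t)) (∑ˢ-zero n)

faceSum-distrib-+ : ∀ (Y : Complex n) t (w w′ : Subset n → ℕ) →
  faceSum Y t (λ F → w F + w′ F) ≡ faceSum Y t w + faceSum Y t w′
faceSum-distrib-+ Y t w w′ =
  trans (∑ˢ-cong λ F → []·-distrib-+ (Y F ∧ hasSize F t) (w F) (w′ F))
        (∑ˢ-distrib-+ (λ F → [ Y F ∧ hasSize F t ]· w F) (λ F → [ Y F ∧ hasSize F t ]· w′ F))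

sum-map-faceSum : ∀ (Y : Complex n) t (xs : List A) (w : A → Subset n → ℕ) →
  sum (map (λ a → faceSum Y t (w a)) xs) ≡ faceSum Y t (λ F → sum (map (λ a → w a F) xs))
sum-map-faceSum Y t [] w = sym (faceSum-zero Y t)
sum-map-faceSum Y t (a ∷ xs) w =
  trans (cong (_+_ (faceSum Y t (w a))) (sum-map-faceSum Y t xs w)) (sym (faceSum-distrib-+ Y t (w a) _))

hasSize-∪ : ∀ (G σ : Subset n) t → disjointB G σ ≡ true → hasSize (G ∪ σ) (t + ∣ σ ∣) ≡ hasSize G t
hasSize-∪ G σ t G#σ =
  trans (cong (λ k → does (k ≟ t + ∣ σ ∣)) (∣∪∣ G σ G#σ))
        (does-⇔ (mk⇔ (+-cancelʳ-≡ ∣ σ ∣ ∣ G ∣ t) (cong (λ a → a + ∣ σ ∣)))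
                (∣ G ∣ + ∣ σ ∣ ≟ t + ∣ σ ∣) (∣ G ∣ ≟ t))

faceSum-link : ∀ (Y : Complex n) σ t (w : Subset n → ℕ) →
  faceSum Y (t + ∣ σ ∣) (λ F → [ σ ⊆ᵇ F ]· w F) ≡ faceSum (link Y σ) t (λ G → w (G ∪ σ))
faceSum-link Y σ t w = begin
  ∑ˢ[ F ] [ Y F ∧ hasSize F (t + ∣ σ ∣) ]· [ σ ⊆ᵇ F ]· w F
    ≡⟨ ∑ˢ-cong (λ F → if-swap-then (Y F ∧ hasSize F (t + ∣ σ ∣)) (σ ⊆ᵇ F)) ⟩
  ∑ˢ[ F ] [ σ ⊆ᵇ F ]· [ Y F ∧ hasSize F (t + ∣ σ ∣) ]· w F
    ≡⟨ ∑ˢ-⊇ σ (λ F → [ Y F ∧ hasSize F (t + ∣ σ ∣) ]· w F) ⟩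
  ∑ˢ[ G ] [ disjointB G σ ]· [ Y (G ∪ σ) ∧ hasSize (G ∪ σ) (t + ∣ σ ∣) ]· w (G ∪ σ)
    ≡⟨ ∑ˢ-cong shift ⟩
  ∑ˢ[ G ] [ link Y σ G ∧ hasSize G t ]· w (G ∪ σ) ∎
  where
  open ≡-Reasoning
  shift : ∀ G → [ disjointB G σ ]· [ Y (G ∪ σ) ∧ hasSize (G ∪ σ) (t + ∣ σ ∣) ]· w (G ∪ σ)
              ≡ [ link Y σ G ∧ hasSize G t ]· w (G ∪ σ)
  shift G with disjointB G σ in G#σ
  ... | true = cong (λ b → [ Y (G ∪ σ) ∧ b ]· w (G ∪ σ)) (hasSize-∪ G σ t G#σ)
  ... | false = refl

flagSum-mono-≤ : ∀ (Y : Complex n) t s {w w′ : Subset n → ℕ} →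
  (∀ F ρ → Y F ≡ true → ρ ⊆ F → ∣ ρ ∣ ≡ s → w ρ ≤ w′ ρ) → flagSum Y t s w ≤ flagSum Y t s w′
flagSum-mono-≤ Y t s le =
  faceSum-mono-≤ Y t λ F YF _ → faceSum-mono-≤ (_⊆ᵇ F) s λ ρ ρ⊆F → le F ρ YF (does-true (ρ ⊆? F) ρ⊆F)

flagSum-cong : ∀ (Y : Complex n) t s {w w′ : Subset n → ℕ} →
  (∀ F ρ → Y F ≡ true → ρ ⊆ F → ∣ ρ ∣ ≡ s → w ρ ≡ w′ ρ) → flagSum Y t s w ≡ flagSum Y t s w′
flagSum-cong Y t s eq =
  faceSum-cong Y t λ F YF _ → faceSum-cong (_⊆ᵇ F) s λ ρ ρ⊆F → eq F ρ YF (does-true (ρ ⊆? F) ρ⊆F)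

flagSum-distrib-+ : ∀ (Y : Complex n) t s (w w′ : Subset n → ℕ) →
  flagSum Y t s (λ ρ → w ρ + w′ ρ) ≡ flagSum Y t s w + flagSum Y t s w′
flagSum-distrib-+ Y t s w w′ =
  trans (faceSum-cong Y t (λ F _ _ → faceSum-distrib-+ (_⊆ᵇ F) s w w′))
        (faceSum-distrib-+ Y t (λ F → faceSum (_⊆ᵇ F) s w) (λ F → faceSum (_⊆ᵇ F) s w′))

flagCount-split : ∀ (Y : Complex n) t s (c : Subset n → Bool) (g : Cochain n) →
  flagCount Y t s g ≡ flagCount Y t s (λ ρ → c ρ ∧ g ρ) + flagCount Y t s (λ ρ → not (c ρ) ∧ g ρ)
flagCount-split Y t s c g =
  trans (flagSum-cong Y t s (λ _ ρ _ _ _ → split (c ρ) (g ρ)))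
        (flagSum-distrib-+ Y t s (λ ρ → [ c ρ ∧ g ρ ]) (λ ρ → [ not (c ρ) ∧ g ρ ]))
  where
  split : ∀ a b → [ b ] ≡ [ a ∧ b ] + [ not a ∧ b ]
  split true b = sym (+-identityʳ [ b ])
  split false b = refl

flagCount-link : ∀ (Y : Complex n) σ t s (g : Cochain n) →
  flagCount Y (t + ∣ σ ∣) (s + ∣ σ ∣) (λ ρ → σ ⊆ᵇ ρ ∧ g ρ) ≡ flagCount (link Y σ) t s (localize g σ)
flagCount-link Y σ t s g = begin
  faceSum Y (t + ∣ σ ∣) (λ F → inner F)
    ≡⟨ faceSum-cong Y (t + ∣ σ ∣) (λ F _ _ → inner-⊇ F) ⟩
  faceSum Y (t + ∣ σ ∣) (λ F → [ σ ⊆ᵇ F ]· inner F)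
    ≡⟨ faceSum-link Y σ t inner ⟩
  faceSum (link Y σ) t (λ G → inner (G ∪ σ))
    ≡⟨ faceSum-cong (link Y σ) t (λ G LG _ → inner-link G (proj₁ (∧-true {disjointB G σ} LG))) ⟩
  flagCount (link Y σ) t s (localize g σ) ∎
  where
  open ≡-Reasoning
  inner : Subset _ → ℕ
  inner F = faceSum (_⊆ᵇ F) (s + ∣ σ ∣) (λ ρ → [ σ ⊆ᵇ ρ ∧ g ρ ])
  inner-⊇ : ∀ F → inner F ≡ [ σ ⊆ᵇ F ]· inner F
  inner-⊇ F with σ ⊆ᵇ F in σ⊆F
  ... | true = refl
  ... | false = trans (faceSum-cong (_⊆ᵇ F) (s + ∣ σ ∣) vanish) (faceSum-zero (_⊆ᵇ F) (s + ∣ σ ∣))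
    where
    vanish : ∀ ρ → ρ ⊆ᵇ F ≡ true → ∣ ρ ∣ ≡ s + ∣ σ ∣ → [ σ ⊆ᵇ ρ ∧ g ρ ] ≡ 0
    vanish ρ ρ⊆F _ with σ ⊆ᵇ ρ in σ⊆ρ
    ... | false = refl
    ... | true with () ← trans (sym σ⊆F) (⊆ᵇ-trans σ ρ F σ⊆ρ ρ⊆F)
  inner-link : ∀ G → disjointB G σ ≡ true → inner (G ∪ σ) ≡ faceSum (_⊆ᵇ G) s (λ τ → [ localize g σ τ ])
  inner-link G G#σ = begin
    faceSum (_⊆ᵇ (G ∪ σ)) (s + ∣ σ ∣) (λ ρ → [ σ ⊆ᵇ ρ ∧ g ρ ])
      ≡⟨ faceSum-cong (_⊆ᵇ (G ∪ σ)) (s + ∣ σ ∣) (λ ρ _ _ → if-∧ (σ ⊆ᵇ ρ)) ⟩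
    faceSum (_⊆ᵇ (G ∪ σ)) (s + ∣ σ ∣) (λ ρ → [ σ ⊆ᵇ ρ ]· [ g ρ ])
      ≡⟨ faceSum-link (_⊆ᵇ (G ∪ σ)) σ s (λ ρ → [ g ρ ]) ⟩
    faceSum (link (_⊆ᵇ (G ∪ σ)) σ) s (λ τ → [ g (τ ∪ σ) ])
      ≡⟨ faceSum-cong-complex s _ (link-⊆ᵇ G σ G#σ) ⟩
    faceSum (_⊆ᵇ G) s (λ τ → [ g (τ ∪ σ) ])
      ≡⟨ faceSum-cong (_⊆ᵇ G) s (λ τ _ _ → cong (λ ρ → [ g ρ ]) (∪-comm τ σ)) ⟩
    faceSum (_⊆ᵇ G) s (λ τ → [ localize g σ τ ]) ∎

sum-map-flagSum : ∀ (Y : Complex n) t s (xs : List A) (w : A → Subset n → ℕ) →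
  sum (map (λ a → flagSum Y t s (w a)) xs) ≡ flagSum Y t s (λ ρ → sum (map (λ a → w a ρ) xs))
sum-map-flagSum Y t s xs w =
  trans (sum-map-faceSum Y t xs (λ a F → faceSum (_⊆ᵇ F) s (w a)))
        (faceSum-cong Y t (λ F _ _ → sum-map-faceSum (_⊆ᵇ F) s xs w))

-- Coboundaries

⨁ˡ-elems : ∀ (σ : Subset n) (φ : Fin n → Bool) → ⨁ˡ φ (elems σ) ≡ Xor.sum (λ v → v ∈ᵇ σ ∧ φ v)
⨁ˡ-elems {n} σ φ = trans (⨁ˡ-filter (λ v → T? (v ∈ᵇ σ)) φ (allFin n)) (⨁ˡ-tabulate n id _)

⨁ˡ-elems-false : ∀ (σ : Subset n) (φ : Fin n → Bool) → (∀ v → v ∈ᵇ σ ≡ true → φ v ≡ false) →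
  ⨁ˡ φ (elems σ) ≡ false
⨁ˡ-elems-false {n} σ φ vanish =
  trans (⨁ˡ-filter (λ v → T? (v ∈ᵇ σ)) φ (allFin n)) (⨁ˡ-false _ (allFin n) vanish∧)
  where
  vanish∧ : ∀ v → (v ∈ᵇ σ ∧ φ v) ≡ false
  vanish∧ v with v ∈ᵇ σ in v∈σ
  ... | true = vanish v v∈σ
  ... | false = refl

δ-∪ : ∀ (g : Cochain n) σ τ → disjointB τ σ ≡ true →
  δ g (σ ∪ τ) ≡ ⨁ˡ (λ v → g ((σ - v) ∪ τ)) (elems σ) xor ⨁ˡ (λ v → g (σ ∪ (τ [ v ]≔ outside))) (elems τ)
δ-∪ g σ τ τ#σ = begin
  ⨁ˡ (λ v → g ((σ ∪ τ) [ v ]≔ outside)) (elems (σ ∪ τ))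
    ≡⟨ ⨁ˡ-elems (σ ∪ τ) _ ⟩
  Xor.sum (λ v → v ∈ᵇ (σ ∪ τ) ∧ g ((σ ∪ τ) [ v ]≔ outside))
    ≡⟨ Xor.sum-cong-≗ split ⟩
  Xor.sum (λ v → (v ∈ᵇ σ ∧ g ((σ - v) ∪ τ)) xor (v ∈ᵇ τ ∧ g (σ ∪ (τ [ v ]≔ outside))))
    ≡⟨ Xor.∑-distrib-+ (λ v → v ∈ᵇ σ ∧ g ((σ - v) ∪ τ))
                        (λ v → v ∈ᵇ τ ∧ g (σ ∪ (τ [ v ]≔ outside))) ⟩
  Xor.sum (λ v → v ∈ᵇ σ ∧ g ((σ - v) ∪ τ)) xor Xor.sum (λ v → v ∈ᵇ τ ∧ g (σ ∪ (τ [ v ]≔ outside)))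
    ≡⟨ sym (cong₂ _xor_ (⨁ˡ-elems σ _) (⨁ˡ-elems τ _)) ⟩
  ⨁ˡ (λ v → g ((σ - v) ∪ τ)) (elems σ) xor ⨁ˡ (λ v → g (σ ∪ (τ [ v ]≔ outside))) (elems τ) ∎
  where
  open ≡-Reasoning
  split : ∀ v → (v ∈ᵇ (σ ∪ τ) ∧ g ((σ ∪ τ) [ v ]≔ outside))
              ≡ (v ∈ᵇ σ ∧ g ((σ - v) ∪ τ)) xor (v ∈ᵇ τ ∧ g (σ ∪ (τ [ v ]≔ outside)))
  split v rewrite ∈ᵇ-∪ v σ τ with v ∈ᵇ σ in v∈σ | v ∈ᵇ τ in v∈τ
  ... | true | true with () ← trans (sym v∈τ) (∈ᵇ-disjoint v τ σ τ#σ v∈σ)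
  ... | true | false = trans (cong g (sym (-∪≡[]≔outside σ τ v τ#σ v∈σ))) (sym (xor-identityʳ _))
  ... | false | true = cong g (sym (∪[]≔outside σ τ v v∈σ))
  ... | false | false = refl

lift : Subset n → Cochain n → Cochain n
lift σ h ρ = σ ⊆ᵇ ρ ∧ h (ρ ─ σ)

δ-lift-outside : ∀ σ (h : Cochain n) ρ → σ ⊆ᵇ ρ ≡ false → δ (lift σ h) ρ ≡ false
δ-lift-outside σ h ρ σ⊈ρ = ⨁ˡ-false _ (elems ρ) λ v →
  cong (_∧ h ((ρ [ v ]≔ outside) ─ σ)) (trans (⊆ᵇ-[]≔outside σ ρ v) (cong (_∧ not (v ∈ᵇ σ)) σ⊈ρ))

δ-lift : ∀ σ (h : Cochain n) τ → disjointB τ σ ≡ true → δ (lift σ h) (σ ∪ τ) ≡ δ h τ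
δ-lift σ h τ τ#σ =
  trans (δ-∪ (lift σ h) σ τ τ#σ) (cong₂ _xor_ (⨁ˡ-elems-false σ _ off-link) (⨁ˡ-cong (elems τ) on-link))
  where
  off-link : ∀ v → v ∈ᵇ σ ≡ true → lift σ h ((σ - v) ∪ τ) ≡ false
  off-link v v∈σ = cong (_∧ h (((σ - v) ∪ τ) ─ σ)) (begin
    σ ⊆ᵇ ((σ - v) ∪ τ)                 ≡⟨ cong (σ ⊆ᵇ_) (-∪≡[]≔outside σ τ v τ#σ v∈σ) ⟩
    σ ⊆ᵇ ((σ ∪ τ) [ v ]≔ outside)      ≡⟨ ⊆ᵇ-[]≔outside σ (σ ∪ τ) v ⟩
    σ ⊆ᵇ (σ ∪ τ) ∧ not (v ∈ᵇ σ)        ≡⟨ cong (λ b → σ ⊆ᵇ (σ ∪ τ) ∧ not b) v∈σ ⟩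
    σ ⊆ᵇ (σ ∪ τ) ∧ false               ≡⟨ ∧-zeroʳ _ ⟩
    false                              ∎)
    where open ≡-Reasoning
  on-link : ∀ v → lift σ h (σ ∪ (τ [ v ]≔ outside)) ≡ h (τ [ v ]≔ outside)
  on-link v = cong₂ _∧_ (⊆ᵇ-∪ σ (τ [ v ]≔ outside))
                        (cong h (∪-─-cancel σ (τ [ v ]≔ outside) ([]≔outside-disjoint τ σ v τ#σ)))

δ-localize : ∀ (f : Cochain n) σ τ → disjointB τ σ ≡ true → δ f (σ ∪ τ) ≡ false →
  δ (localize f σ) τ ≡ ⨁ˡ (λ u → f ((σ - u) ∪ τ)) (elems σ)
δ-localize f σ τ τ#σ δf≡0 = xor≡false⇒≡ _ _ (trans (sym (δ-∪ f σ τ τ#σ)) δf≡0)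
  where
  xor≡false⇒≡ : ∀ a b → a xor b ≡ false → b ≡ a
  xor≡false⇒≡ false false _ = refl
  xor≡false⇒≡ true true _ = refl

-- Fractions

toℚᵘ-frac : ∀ a c → toℚᵘ (frac a (suc c)) ℚᵘ.≃ mkℚᵘ (+ a) c
toℚᵘ-frac a c = toℚᵘ-fromℚᵘ (mkℚᵘ (+ a) c)

frac-mono-≤ : ∀ {a b} D → a ≤ b → frac a D ≤ℚ frac b D
frac-mono-≤ zero _ = ℚ.≤-refl
frac-mono-≤ {a} {b} (suc c) a≤b = toℚᵘ-cancel-≤
  (ℚᵘ.≤-respˡ-≃ (ℚᵘ.≃-sym (toℚᵘ-frac a c)) (ℚᵘ.≤-respʳ-≃ (ℚᵘ.≃-sym (toℚᵘ-frac b c)) (*≤* cross)))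
  where
  cross : + a ℤ.* + suc c ℤ.≤ + b ℤ.* + suc c
  cross = subst₂ ℤ._≤_ (ℤ.pos-* a (suc c)) (ℤ.pos-* b (suc c)) (ℤ.+≤+ (ℕ.*-monoˡ-≤ (suc c) a≤b))

frac-cancel-≤ : ∀ {a b} D → 1 ≤ D → frac a D ≤ℚ frac b D → a ≤ b
frac-cancel-≤ {a} {b} (suc c) _ le
  with ℚᵘ.≤-respˡ-≃ (toℚᵘ-frac a c) (ℚᵘ.≤-respʳ-≃ (toℚᵘ-frac b c) (toℚᵘ-mono-≤ le))
... | *≤* cross = ℕ.*-cancelʳ-≤ a b (suc c)
  (ℤ.drop‿+≤+ (subst₂ ℤ._≤_ (sym (ℤ.pos-* a (suc c))) (sym (ℤ.pos-* b (suc c))) cross))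

frac-+ : ∀ a b D → frac a D ℚ.+ frac b D ≡ frac (a + b) D
frac-+ a b zero = refl
frac-+ a b (suc c) = toℚᵘ-injective
  (ℚᵘ.≃-trans (ℚ.toℚᵘ-homo-+ (frac a (suc c)) (frac b (suc c)))
  (ℚᵘ.≃-trans (ℚᵘ.+-cong (toℚᵘ-frac a c) (toℚᵘ-frac b c))
  (ℚᵘ.≃-trans (*≡* cross) (ℚᵘ.≃-sym (toℚᵘ-frac (a + b) c)))))
  where
  open +-*-Solver using (_:+_; _:*_; _:=_) renaming (solve to solveℤ)
  cross : (+ a ℤ.* + suc c ℤ.+ + b ℤ.* + suc c) ℤ.* + suc c ≡ + (a + b) ℤ.* (+ (suc c ℕ.* suc c))
  cross = trans (solveℤ 3 (λ x y z → (x :* z :+ y :* z) :* z := (x :+ y) :* (z :* z)) refl (+ a) (+ b) (+ suc c))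
                (cong₂ ℤ._*_ (sym (ℤ.pos-+ a b)) (sym (ℤ.pos-* (suc c) (suc c))))

frac-zero : ∀ D → frac 0 D ≡ 0ℚ
frac-zero zero = refl
frac-zero (suc c) = toℚᵘ-injective (ℚᵘ.≃-trans (toℚᵘ-frac 0 c) (*≡* refl))

frac-nonNegative : ∀ a D → 0ℚ ≤ℚ frac a D
frac-nonNegative a D = subst (_≤ℚ frac a D) (frac-zero D) (frac-mono-≤ D z≤n)

sum-map-frac : ∀ (xs : List A) (B : A → ℕ) D →
  foldr ℚ._+_ 0ℚ (map (λ x → frac (B x) D) xs) ≡ frac (sum (map B xs)) D
sum-map-frac [] B D = sym (frac-zero D)
sum-map-frac (x ∷ xs) B D = trans (cong (frac (B x) D ℚ.+_) (sum-map-frac xs B D)) (frac-+ (B x) _ D)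

[1+ℓ]*1/[1+ℓ] : ∀ ℓ → ((+ suc ℓ) / 1) * ((+ 1) / suc ℓ) ≡ 1ℚ
[1+ℓ]*1/[1+ℓ] ℓ = toℚᵘ-injective
  (ℚᵘ.≃-trans (ℚ.toℚᵘ-homo-* ((+ suc ℓ) / 1) ((+ 1) / suc ℓ))
  (ℚᵘ.≃-trans (ℚᵘ.*-cong (toℚᵘ-fromℚᵘ (mkℚᵘ (+ suc ℓ) 0)) (toℚᵘ-fromℚᵘ (mkℚᵘ (+ 1) ℓ))) (*≡* cross)))
  where
  cross : (+ suc ℓ ℤ.* + 1) ℤ.* + 1 ≡ + 1 ℤ.* + (1 ℕ.* suc ℓ)
  cross = trans (ℤ.*-identityʳ _) (trans (ℤ.*-identityʳ _)
            (trans (cong +_ (sym (ℕ.*-identityˡ (suc ℓ)))) (sym (ℤ.*-identityˡ _))))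

mean≡sum*1/length : ∀ (xs : List ℚ) ℓ → length xs ≡ suc ℓ → mean xs ≡ foldr ℚ._+_ 0ℚ xs * ((+ 1) / suc ℓ)
mean≡sum*1/length (x ∷ xs) ℓ len = cong (λ k → foldr ℚ._+_ 0ℚ (x ∷ xs) * ((+ 1) / suc k)) (ℕ.suc-injective len)

≤-[1+ℓ]/β*mean : ∀ (β : ℚ) (βpos : Positive β) x (xs : List ℚ) ℓ → length xs ≡ suc ℓ →
  β * x ≤ℚ foldr ℚ._+_ 0ℚ xs → x ≤ℚ (((+ suc ℓ) / 1) * (1/ β) {{pos⇒nonZero β {{βpos}}}}) * mean xs
≤-[1+ℓ]/β*mean β βpos x xs ℓ len βx≤S =
  subst₂ _≤ℚ_ cancel-β rearrange (ℚ.*-monoˡ-≤-nonNeg β⁻¹ βx≤S)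
  where
  instance _ = pos⇒nonZero β {{βpos}}
  β⁻¹ = 1/ β
  instance _ = ℚ.pos⇒nonNeg β⁻¹ {{ℚ.1/pos⇒pos β {{βpos}}}}
  S = foldr ℚ._+_ 0ℚ xs
  c = (+ suc ℓ) / 1
  c⁻¹ = (+ 1) / suc ℓ
  open ≡-Reasoning
  cancel-β : β⁻¹ * (β * x) ≡ x
  cancel-β = begin
    β⁻¹ * (β * x) ≡⟨ sym (ℚ.*-assoc β⁻¹ β x) ⟩
    (β⁻¹ * β) * x ≡⟨ cong (_* x) (ℚ.*-inverseˡ β) ⟩
    1ℚ * x        ≡⟨ ℚ.*-identityˡ x ⟩
    x             ∎
  rearrange : β⁻¹ * S ≡ (c * β⁻¹) * mean xs
  rearrange = sym (begin
    (c * β⁻¹) * mean xs   ≡⟨ cong ((c * β⁻¹) *_) (mean≡sum*1/length xs ℓ len) ⟩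
    (c * β⁻¹) * (S * c⁻¹) ≡⟨ solve 4 (λ c i s d → (c ∙ i) ∙ (s ∙ d) ⊜ (i ∙ s) ∙ (c ∙ d)) refl c β⁻¹ S c⁻¹ ⟩
    (β⁻¹ * S) * (c * c⁻¹) ≡⟨ cong ((β⁻¹ * S) *_) ([1+ℓ]*1/[1+ℓ] ℓ) ⟩
    (β⁻¹ * S) * 1ℚ        ≡⟨ ℚ.*-identityʳ (β⁻¹ * S) ⟩
    β⁻¹ * S               ∎)

-- Minimal cochains and links

IsMinimal : Complex n → (m s : ℕ) → Cochain n → Set
IsMinimal Y m s f = ∀ g → IsCoboundary Y s g → norm Y m s f ≤ℚ norm Y m s (f ⊕ g)

1≤nCk : ∀ a b → b ≤ a → 1 ≤ a C b
1≤nCk a zero _ = ≤-refl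
1≤nCk (suc a) (suc b) (s≤s b≤a) =
  ≤-trans (1≤nCk a b b≤a) (subst (a C b ≤_) (nCk+nC[k+1]≡[n+1]C[k+1] a b) (m≤m+n _ _))

faceCount-pos : ∀ (Y : Complex n) F t → Y F ≡ true → ∣ F ∣ ≡ t → 1 ≤ faceCount Y t
faceCount-pos Y F t YF ∣F∣ = subst (λ b → [ b ]· 1 ≤ faceCount Y t)
  (cong₂ _∧_ YF (dec-true (∣ F ∣ ≟ t) ∣F∣)) (term≤∑ˢ (λ G → [ Y G ∧ hasSize G t ]· 1) F)

norm-mono-≤ : ∀ (Y : Complex n) m s {g g′} → flagCount Y (suc m) s g ≤ flagCount Y (suc m) s g′ →
  norm Y m s g ≤ℚ norm Y m s g′
norm-mono-≤ Y m s {g} {g′} le =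
  subst₂ _≤ℚ_ (sym (norm≡frac-flagCount Y m s g)) (sym (norm≡frac-flagCount Y m s g′))
              (frac-mono-≤ (flagTotal Y (suc m) s) le)

norm-cancel-≤ : ∀ (Y : Complex n) m s {g g′} → 1 ≤ faceCount Y (suc m) → s ≤ suc m →
  norm Y m s g ≤ℚ norm Y m s g′ → flagCount Y (suc m) s g ≤ flagCount Y (suc m) s g′
norm-cancel-≤ Y m s {g} {g′} faces s≤1+m le =
  frac-cancel-≤ (flagTotal Y (suc m) s) (*-mono-≤ faces (1≤nCk (suc m) s s≤1+m))
    (subst₂ _≤ℚ_ (norm≡frac-flagCount Y m s g) (norm≡frac-flagCount Y m s g′) le)

norm-nonNegative : ∀ (Y : Complex n) m s g → 0ℚ ≤ℚ norm Y m s g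
norm-nonNegative Y m s g =
  subst (0ℚ ≤ℚ_) (sym (norm≡frac-flagCount Y m s g)) (frac-nonNegative _ (flagTotal Y (suc m) s))

norm-⊕-self : ∀ (Y : Complex n) m s g → norm Y m s (g ⊕ g) ≡ 0ℚ
norm-⊕-self Y m s g = begin
  norm Y m s (g ⊕ g)                                   ≡⟨ norm≡frac-flagCount Y m s (g ⊕ g) ⟩
  frac (flagCount Y (suc m) s (g ⊕ g)) D               ≡⟨ cong (λ a → frac a D) vanish ⟩
  frac 0 D                                             ≡⟨ frac-zero D ⟩
  0ℚ                                                   ∎
  where
  open ≡-Reasoning
  D = flagTotal Y (suc m) s
  vanish : flagCount Y (suc m) s (g ⊕ g) ≡ 0
  vanish = trans (flagSum-cong Y (suc m) s (λ _ ρ _ _ _ → cong [_] (xor-same (g ρ))))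
                 (trans (faceSum-cong Y (suc m) (λ F _ _ → faceSum-zero (_⊆ᵇ F) s)) (faceSum-zero Y (suc m)))

-- Being a coboundary is undecidable but the inequality is decidable, and its failure is refuted
-- both for coboundaries (by minimality) and for non-coboundaries (by the expander).
IsMinimal⇒δ-expansion : ∀ {Y : Complex n} {m s g} β → NonNegative β → IsCoboundaryExpander β Y m → s ≤ m →
  IsMinimal Y m s g → β * norm Y m s g ≤ℚ norm Y m (suc s) (δ g)
IsMinimal⇒δ-expansion {Y = Y} {m} {s} {g} β β≥0 expander s≤m minimal
  with β * norm Y m s g ℚ.≤? norm Y m (suc s) (δ g)
... | yes βx≤y = βx≤y
... | no βx≰y = ⊥-elim (βx≰y (non-coboundary (λ cob → βx≰y (coboundary cob))))
  where
  instance _ = β≥0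
  coboundary : IsCoboundary Y s g → β * norm Y m s g ≤ℚ norm Y m (suc s) (δ g)
  coboundary cob = begin
    β * norm Y m s g        ≤⟨ ℚ.*-monoˡ-≤-nonNeg β
                                  (subst (norm Y m s g ≤ℚ_) (norm-⊕-self Y m s g) (minimal g cob)) ⟩
    β * 0ℚ                  ≡⟨ ℚ.*-zeroʳ β ⟩
    0ℚ                      ≤⟨ norm-nonNegative Y m (suc s) (δ g) ⟩
    norm Y m (suc s) (δ g)  ∎
    where open ℚ.≤-Reasoning
  non-coboundary : ¬ IsCoboundary Y s g → β * norm Y m s g ≤ℚ norm Y m (suc s) (δ g)
  non-coboundary ¬cob with expander s s≤m g ¬cob
  ... | b , cob , βx≤y = ℚ.≤-trans (ℚ.*-monoˡ-≤-nonNeg β (minimal b cob)) βx≤y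

IsMinimal-link : ∀ {d S m s} {X : Complex n} → IsComplex d X → ∀ σ → m + ∣ σ ∣ ≡ d → s + ∣ σ ∣ ≡ S →
  s ≤ suc m → ∀ f → IsMinimal X d S f → IsMinimal (link X σ) m s (localize f σ)
IsMinimal-link {m = m} {zero} {X} isC σ refl refl _ f _ b b≡0 =
  norm-mono-≤ (link X σ) m 0 (≤-reflexive (flagSum-cong (link X σ) (suc m) 0 λ F ρ LF ρ⊆F ∣ρ∣ →
    cong [_] (sym (trans (cong (f (σ ∪ ρ) xor_) (b≡0 ρ (link-downClosed X σ downClosed F ρ ρ⊆F LF) ∣ρ∣))
                         (xor-identityʳ (f (σ ∪ ρ)))))))
  where open IsComplex isC
IsMinimal-link {m = m} {suc s} {X} isC σ refl refl s≤m f minimal b (h , δh≡b) =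
  norm-mono-≤ L m (suc s) (begin
    flagCount L (suc m) (suc s) (localize f σ)        ≡⟨ flagCount-link X σ (suc m) (suc s) f ⟨
    flagCount X t s⁺ (λ ρ → σ ⊆ᵇ ρ ∧ f ρ)              ≤⟨ on-star ⟩
    flagCount X t s⁺ (λ ρ → σ ⊆ᵇ ρ ∧ (f ⊕ g) ρ)        ≡⟨ flagCount-link X σ (suc m) (suc s) (f ⊕ g) ⟩
    flagCount L (suc m) (suc s) (localize (f ⊕ g) σ)  ≡⟨ on-link ⟩
    flagCount L (suc m) (suc s) (localize f σ ⊕ b)    ∎)
  where
  open IsComplex isC
  open ℕ.≤-Reasoning
  L = link X σ
  t = suc m + ∣ σ ∣
  s⁺ = suc s + ∣ σ ∣
  g = δ (lift σ h)
  counts : flagCount X t s⁺ f ≤ flagCount X t s⁺ (f ⊕ g)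
  counts with pure _ nonempty
  ... | top , _ , Xtop , ∣top∣ =
    norm-cancel-≤ X (m + ∣ σ ∣) s⁺ (faceCount-pos X top t Xtop ∣top∣) (ℕ.+-monoˡ-≤ ∣ σ ∣ s≤m)
      (minimal g (lift σ h , λ _ _ _ → refl))
  off-star : flagCount X t s⁺ (λ ρ → not (σ ⊆ᵇ ρ) ∧ (f ⊕ g) ρ)
           ≡ flagCount X t s⁺ (λ ρ → not (σ ⊆ᵇ ρ) ∧ f ρ)
  off-star = flagSum-cong X t s⁺ λ _ ρ _ _ _ → cong [_] (unchanged ρ)
    where
    unchanged : ∀ ρ → (not (σ ⊆ᵇ ρ) ∧ (f ⊕ g) ρ) ≡ (not (σ ⊆ᵇ ρ) ∧ f ρ)
    unchanged ρ with σ ⊆ᵇ ρ in σ⊈ρ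
    ... | true = refl
    ... | false = trans (cong (f ρ xor_) (δ-lift-outside σ h ρ σ⊈ρ)) (xor-identityʳ (f ρ))
  on-star : flagCount X t s⁺ (λ ρ → σ ⊆ᵇ ρ ∧ f ρ) ≤ flagCount X t s⁺ (λ ρ → σ ⊆ᵇ ρ ∧ (f ⊕ g) ρ)
  on-star = +-cancelʳ-≤ (flagCount X t s⁺ (λ ρ → not (σ ⊆ᵇ ρ) ∧ f ρ)) _ _
    (subst₂ _≤_ (flagCount-split X t s⁺ (σ ⊆ᵇ_) f)
                  (trans (flagCount-split X t s⁺ (σ ⊆ᵇ_) (f ⊕ g))
                         (cong (_+_ (flagCount X t s⁺ (λ ρ → σ ⊆ᵇ ρ ∧ (f ⊕ g) ρ))) off-star)) counts)
  on-link : flagCount L (suc m) (suc s) (localize (f ⊕ g) σ) ≡ flagCount L (suc m) (suc s) (localize f σ ⊕ b)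
  on-link = flagSum-cong L (suc m) (suc s) λ F τ LF τ⊆F ∣τ∣ →
    let Lτ = link-downClosed X σ downClosed F τ τ⊆F LF in
    cong (λ c → [ f (σ ∪ τ) xor c ])
         (trans (δ-lift σ h τ (proj₁ (∧-true {disjointB τ σ} Lτ))) (δh≡b τ Lτ ∣τ∣))

map-norm-link-link : ∀ (X : Complex n) σ m s (g : Fin n → Cochain n) →
  map (λ u → norm (link X σ) m s (g u)) (elems σ)
    ≡ map (λ u → norm (link (link X (σ - u)) ⁅ u ⁆) m s (g u)) (elems σ)
map-norm-link-link {n} X σ m s g = map-cong-local (All.map
  (λ {u} u∈σ → norm-cong-complex (λ τ → sym (link-link X σ u (Equivalence.to T-≡ u∈σ) τ)) m s (g u))
  (all-filter (λ u → T? (u ∈ᵇ σ)) (allFin n)))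

norm-δ-localize≤ : ∀ {S} {X : Complex n} → IsDownClosed X → ∀ σ m s → s + ∣ σ ∣ ≡ S → ∀ f → IsCocycle X S f →
  norm (link X σ) m (suc s) (δ (localize f σ))
    ≤ℚ foldr ℚ._+_ 0ℚ (map (λ u → norm (link (link X (σ - u)) ⁅ u ⁆) m (suc s)
                                        (restrict (localize f (σ - u)) ⁅ u ⁆))
                           (elems σ))
norm-δ-localize≤ {X = X} downClosed σ m s refl f cocycle = begin
  norm L m (suc s) (δ (localize f σ))
    ≡⟨ norm≡frac-flagCount L m (suc s) (δ (localize f σ)) ⟩
  frac (flagCount L (suc m) (suc s) (δ (localize f σ))) D
    ≤⟨ frac-mono-≤ D (≤-trans bound
                        (≤-reflexive (sym (sum-map-flagSum L (suc m) (suc s) (elems σ) λ u τ → [ g u τ ])))) ⟩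
  frac (sum (map (λ u → flagCount L (suc m) (suc s) (g u)) (elems σ))) D
    ≡⟨ sum-map-frac (elems σ) (λ u → flagCount L (suc m) (suc s) (g u)) D ⟨
  foldr ℚ._+_ 0ℚ (map (λ u → frac (flagCount L (suc m) (suc s) (g u)) D) (elems σ))
    ≡⟨ cong (foldr ℚ._+_ 0ℚ) (map-cong (λ u → norm≡frac-flagCount L m (suc s) (g u)) (elems σ)) ⟨
  foldr ℚ._+_ 0ℚ (map (λ u → norm L m (suc s) (g u)) (elems σ))
    ≡⟨ cong (foldr ℚ._+_ 0ℚ) (map-norm-link-link X σ m (suc s) g) ⟩
  foldr ℚ._+_ 0ℚ (map (λ u → norm (link (link X (σ - u)) ⁅ u ⁆) m (suc s) (g u)) (elems σ)) ∎
  where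
  open ℚ.≤-Reasoning
  L = link X σ
  D = flagTotal L (suc m) (suc s)
  g : _ → Cochain _
  g u = restrict (localize f (σ - u)) ⁅ u ⁆
  bound : flagCount L (suc m) (suc s) (δ (localize f σ))
        ≤ flagSum L (suc m) (suc s) (λ τ → sum (map (λ u → [ g u τ ]) (elems σ)))
  bound = flagSum-mono-≤ L (suc m) (suc s) λ F τ LF τ⊆F ∣τ∣ →
    let Lτ = link-downClosed X σ downClosed F τ τ⊆F LF
        τ#σ = proj₁ (∧-true {disjointB τ σ} Lτ)
        Xσ∪τ = trans (cong X (∪-comm σ τ)) (proj₂ (∧-true {disjointB τ σ} Lτ))
        ∣σ∪τ∣ = trans (cong ∣_∣ (∪-comm σ τ)) (trans (∣∪∣ τ σ τ#σ) (cong (λ a → a + ∣ σ ∣) ∣τ∣))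
    in subst (λ b → [ b ] ≤ sum (map (λ u → [ g u τ ]) (elems σ)))
             (sym (δ-localize f σ τ τ#σ (cocycle (σ ∪ τ) Xσ∪τ ∣σ∪τ∣)))
             ([⨁ˡ]≤ (λ u → g u τ) (elems σ))

theorem5p1 : ∀ {n : ℕ} (d : ℕ) (X : Complex n) → IsComplex d X →
  (β : ℚ) (βpos : Positive β) →
  (∀ σ → X σ ≡ true → 1 ≤ ∣ σ ∣ → ∣ σ ∣ ≤ d ∸ 1 →
    IsCoboundaryExpander β (link X σ) (d ∸ ∣ σ ∣)) →
  (ℓ k : ℕ) → ℓ < k → k < d →
  (f : Cochain n) → IsCocycle X (suc k) f →
  (∀ g → IsCoboundary X (suc k) g → norm X d (suc k) f ≤ℚ norm X d (suc k) (f ⊕ g)) →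
  ∀ σ → X σ ≡ true → ∣ σ ∣ ≡ suc ℓ →
    norm (link X σ) (d ∸ suc ℓ) (k ∸ ℓ) (localize f σ)
      ≤ℚ (((+ suc ℓ) / 1) * (1/ β) {{pos⇒nonZero β {{βpos}}}})
         * mean (map (λ u → norm (link (link X (σ ─ ⁅ u ⁆)) ⁅ u ⁆) (d ∸ suc ℓ) (suc (k ∸ ℓ))
                                 (restrict (localize f (σ ─ ⁅ u ⁆)) ⁅ u ⁆))
                     (elems σ))
theorem5p1 d X isC β βpos expanders ℓ k ℓ<k k<d f cocycle minimal σ Xσ ∣σ∣≡1+ℓ =
  ≤-[1+ℓ]/β*mean β βpos _ (map term (elems σ)) ℓ
    (trans (length-map term (elems σ)) (trans (length-elems σ) ∣σ∣≡1+ℓ))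
    (ℚ.≤-trans (IsMinimal⇒δ-expansion β (ℚ.pos⇒nonNeg β {{βpos}}) expander s≤m
                  (IsMinimal-link isC σ m+∣σ∣≡d s+∣σ∣≡1+k (ℕ.m≤n⇒m≤1+n s≤m) f minimal))
               (norm-δ-localize≤ downClosed σ m s s+∣σ∣≡1+k f cocycle))
  where
  open IsComplex isC
  m = d ∸ suc ℓ
  s = k ∸ ℓ
  term : Fin _ → ℚ
  term u = norm (link (link X (σ - u)) ⁅ u ⁆) m (suc s) (restrict (localize f (σ - u)) ⁅ u ⁆)
  m+∣σ∣≡d : m + ∣ σ ∣ ≡ d
  m+∣σ∣≡d = trans (cong (_+_ m) ∣σ∣≡1+ℓ) (ℕ.m∸n+n≡m (ℕ.<-trans ℓ<k k<d))
  s+∣σ∣≡1+k : s + ∣ σ ∣ ≡ suc k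
  s+∣σ∣≡1+k = trans (cong (_+_ s) ∣σ∣≡1+ℓ) (trans (+-suc s ℓ) (cong suc (ℕ.m∸n+n≡m (ℕ.<⇒≤ ℓ<k))))
  s≤m : s ≤ m
  s≤m = ℕ.∸-monoˡ-≤ (suc ℓ) k<d
  expander : IsCoboundaryExpander β (link X σ) m
  expander = subst (λ t → IsCoboundaryExpander β (link X σ) (d ∸ t)) ∣σ∣≡1+ℓ
    (expanders σ Xσ (subst (1 ≤_) (sym ∣σ∣≡1+ℓ) (s≤s z≤n))
                    (subst (_≤ d ∸ 1) (sym ∣σ∣≡1+ℓ) (ℕ.∸-monoˡ-≤ 1 (≤-trans (s≤s ℓ<k) k<d))))
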